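{- Let $R$, $\sigma$, $\mathcal T$ and $a$ be as in the context, and let $\mathtt W$ be the right-infinite word obtained from $\sigma^\infty(\mathtt r)$ by deleting its first letter $\mathtt r$. For $n\ge 0$ let $\mathtt W_n$ be the prefix of $\mathtt W$ of length $n$. Then for every $n\ge 0$, $$|\mathtt W_n|_{\mathtt 0}=n-a(n),$$ where $|\mathtt U|_{\mathtt 0}$ denotes the number of occurrences of the letter $\mathtt 0$ in the word $\mathtt U$.
   Context: Let $R=\langle s,r_1,r_2,\ldots\rangle$ be a sequence of nonnegative integers with $s\ge 1$. Let $\Sigma=\{\mathtt r,\mathtt 0,\mathtt 1,\mathtt 2,\ldots\}$ be the infinite alphabet consisting of a letter $\mathtt r$ together with a letter $[j]$ for each integer $j\ge 0$ (so $[0]=\mathtt 0$, $[1]=\mathtt 1$, etc.). For a letter $\mathtt x$ and $m\ge0$, $\mathtt x^m$ is the word of $m$ copies of $\mathtt x$. Let $\sigma$ be the morphism of words over $\Sigma$ defined by $\sigma(\mathtt r)=\mathtt r\,\mathtt 0^{s}$ and $\sigma([j])=[j+1]\,\mathtt 0^{r_{j+1}}$ for $j\ge 0$. Since $\sigma(\mathtt r)$ begins with $\mathtt r$ and $\sigma$ maps no letter to the empty word, each $\sigma^n(\mathtt r)$ is a prefix of $\sigma^{n+1}(\mathtt r)$ and the lengths tend to infinity; $\sigma^\infty(\mathtt r)$ denotes the unique right-infinite word having every $\sigma^n(\mathtt r)$ as a prefix. Let $\mathcal T$ be the infinite rooted ordered tree whose root is labelled $\mathtt r$ and in which the labels of the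 children of any node labelled $\mathtt x$, read left to right, spell $\sigma(\mathtt x)$. For a node $v$, $\ell(v)$ is the number of nodes in the same row (depth) as $v$ lying strictly to its left. Define $a:\mathbb Z\to\mathbb Z_{\ge0}$ by $a(n)=0$ for $n<0$ and $a(\ell(v))=\ell(\mathrm{parent}(v))$ for every non-root node $v$ of $\mathcal T$ (this is well defined). -}

module Defs where

open import Data.Nat using (ℕ; zero; suc; _+_; _≤_; _<_)
open import Data.List using (List; []; _∷_; replicate; concatMap; length; take; drop)
open import Data.Integer using (ℤ; +_)
open import Relation.Binary.PropositionalEquality using (_≡_)

-- The alphabet Σ = {r, 0, 1, 2, ...}: 𝕣 is the letter r, num j is the letter [j].
data Letter : Set where
  𝕣   : Letter
  num : ℕ → Letter

-- The morphism σ, parametrised by s and the sequence r, where (r k) = r_k for k ≥ 1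
-- (the value r 0 is never used).
σ : (s : ℕ) → (r : ℕ → ℕ) → Letter → List Letter
σ s r 𝕣       = 𝕣 ∷ replicate s (num 0)
σ s r (num j) = num (suc j) ∷ replicate (r (suc j)) (num 0)

σ* : (s : ℕ) → (r : ℕ → ℕ) → List Letter → List Letter
σ* s r w = concatMap (σ s r) w

σⁿ𝕣 : (s : ℕ) → (r : ℕ → ℕ) → ℕ → List Letter
σⁿ𝕣 s r zero    = 𝕣 ∷ []
σⁿ𝕣 s r (suc n) = σ* s r (σⁿ𝕣 s r n)

-- Row d of the tree 𝒯 (labels read left to right) is σ^d(r).
row : (s : ℕ) → (r : ℕ → ℕ) → ℕ → List Letter
row = σⁿ𝕣

-- In row d+1, the children of the node of row d at position p (i.e. with ℓ = p)
-- occupy the positions i with  childStart d p ≤ i < childStart d (suc p).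
childStart : (s : ℕ) → (r : ℕ → ℕ) → ℕ → ℕ → ℕ
childStart s r d p = length (σ* s r (take p (row s r d)))

-- a satisfies the defining property a(ℓ(v)) = ℓ(parent v) for every non-root node v:
-- v is the node at position i of row d+1, its parent the node at position p of row d.
IsParentIndexMap : (s : ℕ) → (r : ℕ → ℕ) → (ℤ → ℕ) → Set
IsParentIndexMap s r a =
  ∀ (d p i : ℕ) → p < length (row s r d) →
  childStart s r d p ≤ i → i < childStart s r d (suc p) →
  a (+ i) ≡ p

count0 : List Letter → ℕ
count0 []             = 0
count0 (𝕣 ∷ w)        = count0 w
count0 (num zero ∷ w) = suc (count0 w)
count0 (num (suc _) ∷ w) = count0 w

-- W_n: the prefix of length n of W = σ^∞(r) with its first letter removed.
-- Since s ≥ 1, |σ^(n+1)(r)| ≥ n+2, and σ^(n+1)(r) is a prefix of σ^∞(r),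
-- so this is exactly the length-n prefix of W.
Wpre : (s : ℕ) → (r : ℕ → ℕ) → ℕ → List Letter
Wpre s r n = take n (drop 1 (σⁿ𝕣 s r (suc n)))

-- Each letter is sent by σ to a block consisting of one nonzero letter followed only by 0s.
-- Hence a prefix of σ(w) that ends inside the block of the letter at position p contains
-- exactly p + 1 nonzero letters, so its number of 0s is its length minus (p + 1).  Row n + 1
-- of 𝒯 is 𝕣 W' with W' extending W_n, and the prefix of length n + 1 of that row ends in
-- the block of the parent of the node at position n, which is at position a(n) of row n.
module Submission where

open import Defs
open import Data.Nat using (ℕ; _≤_)
open import Data.Integer using (ℤ; +_; _-_; _<_; 0ℤ)
open import Relation.Binary.PropositionalEquality using (_≡_)

open import Data.Nat as ℕ using (zero; suc; _+_; z≤n; s≤s)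
open import Data.Nat.Properties as ℕ
  using (≤-refl; ≤-trans; <-trans; n<1+n; +-suc; +-assoc; +-mono-≤; +-cancelˡ-≤;
         +-cancelˡ-<; m≤n+m; m+n∸n≡m; m≤n⇒∃[o]m+o≡n; <-≤-connex; <⇒≱; m≤n⇒m≤1+n)
open import Data.Integer.Properties using ([+m]-[+n]≡m⊖n; ⊖-≥)
open import Data.List using (List; []; _∷_; replicate; length; take; _++_)
open import Data.List.Properties using (length-++; length-replicate; take-all)
open import Data.Product using (∃; _×_; _,_)
open import Data.Sum using (inj₁; inj₂)
open import Data.Empty using (⊥-elim)
open import Relation.Binary.PropositionalEquality
  using (refl; sym; trans; cong; cong₂; subst; module ≡-Reasoning)

open ≡-Reasoning

count0-++ : ∀ xs ys → count0 (xs ++ ys) ≡ count0 xs + count0 ys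
count0-++ []                 ys = refl
count0-++ (𝕣 ∷ xs)           ys = count0-++ xs ys
count0-++ (num zero ∷ xs)    ys = cong suc (count0-++ xs ys)
count0-++ (num (suc _) ∷ xs) ys = count0-++ xs ys

count0-replicate-0 : ∀ k → count0 (replicate k (num 0)) ≡ k
count0-replicate-0 zero    = refl
count0-replicate-0 (suc k) = cong suc (count0-replicate-0 k)

count0-take-replicate-0 : ∀ {i} k → i ≤ k → count0 (take i (replicate k (num 0))) ≡ i
count0-take-replicate-0 k       z≤n       = refl
count0-take-replicate-0 (suc k) (s≤s i≤k) = cong suc (count0-take-replicate-0 k i≤k)

take-++-length : ∀ {A : Set} (xs ys : List A) k → take (length xs + k) (xs ++ ys) ≡ xs ++ take k ys
take-++-length []       ys k = refl
take-++-length (x ∷ xs) ys k = cong (x ∷_) (take-++-length xs ys k)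

take-++-≤ : ∀ {A : Set} (xs ys : List A) {k} → k ≤ length xs → take k (xs ++ ys) ≡ take k xs
take-++-≤ xs       ys {zero}  _         = refl
take-++-≤ (x ∷ xs) ys {suc k} (s≤s k≤n) = cong (x ∷_) (take-++-≤ xs ys k≤n)

module _ (s : ℕ) (r : ℕ → ℕ) where

  count0-σ : ∀ x → suc (count0 (σ s r x)) ≡ length (σ s r x)
  count0-σ 𝕣       = cong suc (trans (count0-replicate-0 s) (sym (length-replicate s)))
  count0-σ (num j) = cong suc (trans (count0-replicate-0 k) (sym (length-replicate k)))
    where k = r (suc j)

  count0-take-σ : ∀ x {i} → i ℕ.< length (σ s r x) → count0 (take (suc i) (σ s r x)) ≡ i
  count0-take-σ 𝕣       (s≤s i≤) =
    count0-take-replicate-0 s (subst (_ ≤_) (length-replicate s) i≤)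
  count0-take-σ (num j) (s≤s i≤) =
    count0-take-replicate-0 (r (suc j)) (subst (_ ≤_) (length-replicate (r (suc j))) i≤)

  count0-take-σ*-block : ∀ w {p i} → p ℕ.< length w →
    length (σ* s r (take p w)) ≤ i → i ℕ.< length (σ* s r (take (suc p) w)) →
    count0 (take (suc i) (σ* s r w)) + p ≡ i
  count0-take-σ*-block (x ∷ xs) {zero} {i} _ _ i<σx = begin
    count0 (take (suc i) (σ s r x ++ σ* s r xs)) + 0 ≡⟨ ℕ.+-identityʳ _ ⟩
    count0 (take (suc i) (σ s r x ++ σ* s r xs))     ≡⟨ cong count0 (take-++-≤ (σ s r x) _ i<σx′) ⟩
    count0 (take (suc i) (σ s r x))                  ≡⟨ count0-take-σ x i<σx′ ⟩
    i                                                ∎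
    where
    i<σx′ : i ℕ.< length (σ s r x)
    i<σx′ = subst (i ℕ.<_) (trans (length-++ (σ s r x)) (ℕ.+-identityʳ _)) i<σx
  count0-take-σ*-block (x ∷ xs) {suc p} {i} (s≤s p<) start≤i i<end
    with m≤n⇒∃[o]m+o≡n (≤-trans (ℕ.m≤m+n (length (σ s r x)) _) (subst (_≤ i) (length-++ (σ s r x)) start≤i))
  ... | j , refl = begin
    count0 (take (suc (L + j)) (σ s r x ++ σ* s r xs)) + suc p
      ≡⟨ cong (λ m → count0 (take m (σ s r x ++ σ* s r xs)) + suc p) (sym (+-suc L j)) ⟩
    count0 (take (L + suc j) (σ s r x ++ σ* s r xs)) + suc p
      ≡⟨ cong (λ w → count0 w + suc p) (take-++-length (σ s r x) _ (suc j)) ⟩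
    count0 (σ s r x ++ take (suc j) (σ* s r xs)) + suc p
      ≡⟨ cong (_+ suc p) (count0-++ (σ s r x) _) ⟩
    count0 (σ s r x) + c + suc p
      ≡⟨ +-suc _ p ⟩
    suc (count0 (σ s r x) + c + p)
      ≡⟨ cong suc (+-assoc (count0 (σ s r x)) c p) ⟩
    suc (count0 (σ s r x)) + (c + p)
      ≡⟨ cong₂ _+_ (count0-σ x) (count0-take-σ*-block xs p< start≤j j<end) ⟩
    L + j
      ∎
    where
    L = length (σ s r x)
    c = count0 (take (suc j) (σ* s r xs))
    start≤j : length (σ* s r (take p xs)) ≤ j
    start≤j = +-cancelˡ-≤ L _ _ (subst (_≤ L + j) (length-++ (σ s r x)) start≤i)
    j<end : j ℕ.< length (σ* s r (take (suc p) xs))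
    j<end = +-cancelˡ-< L _ _ (subst (L + j ℕ.<_) (length-++ (σ s r x)) i<end)

  row-head : ∀ k → ∃ λ t → row s r k ≡ 𝕣 ∷ t
  row-head zero    = [] , refl
  row-head (suc k) with row-head k
  ... | t , eq = replicate s (num 0) ++ σ* s r t , cong (σ* s r) eq

  length-≤-length-σ* : ∀ w → length w ≤ length (σ* s r w)
  length-≤-length-σ* []       = z≤n
  length-≤-length-σ* (x ∷ xs) =
    subst (suc (length xs) ≤_) (sym (length-++ (σ s r x)))
          (+-mono-≤ (σ-nonempty x) (length-≤-length-σ* xs))
    where
    σ-nonempty : ∀ x → 1 ≤ length (σ s r x)
    σ-nonempty 𝕣       = s≤s z≤n
    σ-nonempty (num _) = s≤s z≤n

  length-row : 1 ≤ s → ∀ k → k ℕ.< length (row s r k)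
  length-row 1≤s zero    = s≤s z≤n
  length-row 1≤s (suc k) with row-head k
  ... | t , eq rewrite eq =
    s≤s (subst (suc k ≤_) (sym (length-++ (replicate s (num 0))))
          (+-mono-≤ (subst (1 ≤_) (sym (length-replicate s)) 1≤s)
                    (≤-trans k≤t (length-≤-length-σ* t))))
    where
    k≤t : k ≤ length t
    k≤t = ℕ.≤-pred (subst (λ w → suc k ≤ length w) eq (length-row 1≤s k))

crossing-index : (f : ℕ → ℕ) {n L : ℕ} → f 0 ≤ n → n ℕ.< f L →
                 ∃ λ p → p ℕ.< L × f p ≤ n × n ℕ.< f (suc p)
crossing-index f {L = zero}  f0≤n n<fL = ⊥-elim (<⇒≱ n<fL f0≤n)
crossing-index f {L = suc L} f0≤n n<fL with <-≤-connex _ (f L)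
... | inj₂ fL≤n = L , ≤-refl , fL≤n , n<fL
... | inj₁ n<fL′ with crossing-index f f0≤n n<fL′
...   | p , p<L , fp≤n , n<fp+1 = p , m≤n⇒m≤1+n p<L , fp≤n , n<fp+1

+[m+n]-+n≡+m : ∀ m n → + (m + n) - + n ≡ + m
+[m+n]-+n≡+m m n = trans ([+m]-[+n]≡m⊖n (m + n) n)
                         (trans (⊖-≥ (m≤n+m n m)) (cong +_ (m+n∸n≡m m n)))

lemma2 : (s : ℕ) → 1 ≤ s → (r : ℕ → ℕ) → (a : ℤ → ℕ) →
    (∀ (m : ℤ) → m < 0ℤ → a m ≡ 0) → IsParentIndexMap s r a →
    ∀ (n : ℕ) → + count0 (Wpre s r n) ≡ + n - + a (+ n)
lemma2 s 1≤s r a _ parent n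
  with crossing-index (childStart s r n) z≤n n<childStart-end
  where
  n<childStart-end : n ℕ.< childStart s r n (length (row s r n))
  n<childStart-end rewrite take-all (length (row s r n)) (row s r n) ≤-refl =
    <-trans (n<1+n n) (length-row s r 1≤s (suc n))
... | p , p<len , start≤n , n<end
  with row-head s r (suc n) | count0-take-σ*-block s r (row s r n) p<len start≤n n<end
... | t , eq | count0+p≡n rewrite eq | parent n p n p<len start≤n n<end =
  sym (trans (cong (λ m → + m - + p) (sym count0+p≡n)) (+[m+n]-+n≡+m _ p))
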